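{- For every $n \geq 2$ and every $v \in A_n$, the letters $1$ and $2$ lie in the same cycle of $v$ if and only if $\ell_{T(A_n)}(v)$ is odd.
   Context: $A_n$ is the alternating group on $\{1,\dots,n\}$. Set $T(A_n) = \{(1\,2)(i\,j) \mid 1 \le i<j \le n\}$, a generating set of $A_n$. The length $\ell_{T(A_n)}(v)$ of $v$ is the minimal $k\ge 0$ such that $v$ is a product of $k$ elements of $T(A_n)$. Cycles are those of the disjoint cycle decomposition of $v$, with fixed points counted as cycles of length $1$. -}

module Defs where

open import Data.Nat using (ℕ; zero; suc; _+_; _*_; _≤_)
open import Data.Nat.GeneralisedArithmetic using (iterate)
open import Data.Fin using (Fin; zero; suc) renaming (_<_ to _<ᶠ_)
open import Data.Fin.Permutation using (Permutation′; _⟨$⟩ʳ_; transpose)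
open import Data.List using (List; []; _∷_; length)
open import Data.List.Relation.Unary.All using (All)
open import Data.Product using (Σ; ∃; _×_; _,_; proj₁; proj₂)
open import Relation.Binary.PropositionalEquality using (_≡_; _≢_)

Even : ℕ → Set
Even k = ∃ λ m → k ≡ 2 * m

Odd : ℕ → Set
Odd k = ∃ λ m → k ≡ suc (2 * m)

-- Product of a word of transpositions (i j), as functions composed
-- right-to-left: [t₁, …, t_k] ↦ t₁ ∘ ⋯ ∘ t_k.
evalTransp : ∀ {n} → List (Fin n × Fin n) → Fin n → Fin n
evalTransp []            x = x
evalTransp ((i , j) ∷ w) x = transpose i j ⟨$⟩ʳ evalTransp w x

IsEvenPerm : ∀ {n} → Permutation′ n → Set
IsEvenPerm {n} v =
  ∃ λ (w : List (Fin n × Fin n)) →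
    All (λ p → proj₁ p ≢ proj₂ p) w × Even (length w) × (∀ x → v ⟨$⟩ʳ x ≡ evalTransp w x)

-- The generating set T(A_n) = {(1 2)(i j) | i < j}, for n = m + 2.
-- Letters 1, 2 are the elements zero, suc zero of Fin n.
TIndex : ℕ → Set
TIndex n = Σ (Fin n × Fin n) λ p → proj₁ p <ᶠ proj₂ p

applyT : ∀ {m} → TIndex (suc (suc m)) → Fin (suc (suc m)) → Fin (suc (suc m))
applyT ((i , j) , _) x = transpose zero (suc zero) ⟨$⟩ʳ (transpose i j ⟨$⟩ʳ x)

evalT : ∀ {m} → List (TIndex (suc (suc m))) → Fin (suc (suc m)) → Fin (suc (suc m))
evalT []      x = x
evalT (t ∷ w) x = applyT t (evalT w x)

IsTProduct : ∀ {m} → Permutation′ (suc (suc m)) → ℕ → Set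
IsTProduct {m} v k =
  ∃ λ (w : List (TIndex (suc (suc m)))) → length w ≡ k × (∀ x → v ⟨$⟩ʳ x ≡ evalT w x)

HasTLength : ∀ {m} → Permutation′ (suc (suc m)) → ℕ → Set
HasTLength v k = IsTProduct v k × (∀ k′ → IsTProduct v k′ → k ≤ k′)

SameCycle : ∀ {n} → Permutation′ n → Fin n → Fin n → Set
SameCycle v a b = ∃ λ k → iterate (v ⟨$⟩ʳ_) a k ≡ b

module Submission where

-- Everything is measured by cycles f, the number of cycles of a permutation f of Fin n
-- (counted through their least points).  The basic fact is that composing with a
-- transposition (a b) changes it by exactly one: the cycle through a and b splits, or the
-- two cycles through a and b merge.  Hence a product of ℓ transpositions has
-- cycles + ℓ ≡ n (mod 2) and cycles + ℓ ≥ n, and conversely f is a product of exactly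
-- n ∸ cycles f transpositions.  A word t₁⋯t_k in T(A_n), with s = (1 2), satisfies
-- sᵏ·t₁⋯t_k = (a product of k transpositions), and every such product arises; so a product
-- v of k generators has k ≥ n ∸ cycles (sᵏv), and k = n ∸ cycles (sᵏv) is attained.  Since
-- sᵏ is the identity or s, comparing c = cycles v with c′ = cycles (s·v) = c ± 1, and using
-- that n ∸ c is even for even v, shows that the shortest word has length n ∸ c′ (odd) if
-- 1, 2 share a cycle, and n ∸ c (even) otherwise.

open import Defs
open import Level using (0ℓ)
open import Data.Nat
  using (ℕ; zero; suc; _+_; _*_; _∸_; _≤_; _<_; _≤?_; z≤n; s≤s; 2+)
open import Data.Nat.Properties
  using (≤-refl; ≤-reflexive; ≤-trans; <⇒≤; ≰⇒>; ≤⇒≯; n<1+n; n≤1+n; 1+n≰n; m≤m+n;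
         m≤n⇒m≤1+n; m<1+n⇒m<n∨m≡n; +-comm; +-suc; +-identityʳ; *-suc; +-monoˡ-≤; +-monoˡ-<;
         +-cancelʳ-≡; +-cancelˡ-≤; m+[n∸m]≡n; m∸n+n≡m; [m+n]∸[m+o]≡n∸o; *-distribˡ-∸)
  renaming (suc-injective to ℕ-suc-injective)
open import Data.Nat.Induction using (<-rec)
open import Data.Nat.GeneralisedArithmetic using (iterate)
open import Data.Fin using (Fin; zero; suc; toℕ; fromℕ<)
  renaming (_≤_ to _≤ᶠ_; _≤?_ to _≤ᶠ?_)
open import Data.Fin.Properties
  using (_≟_; pigeonhole; ¬∀⟶∃¬; <-cmp; <⇒≢; toℕ≤pred[n]; toℕ-fromℕ<; any?; all?; suc-injective)
  renaming (≤-antisym to ≤ᶠ-antisym; ≤-reflexive to ≤ᶠ-reflexive)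
open import Data.Fin.Permutation using (Permutation′; _⟨$⟩ʳ_)
open import Data.Fin.Permutation.Components using (transpose; transpose-inverse)
open import Data.Bool using (if_then_else_)
open import Data.List using (List; []; _∷_; length)
open import Data.List.Relation.Unary.All using (All; []; _∷_)
open import Data.Product using (Σ; ∃; _×_; _,_; proj₁; proj₂)
open import Data.Sum using (_⊎_; inj₁; inj₂)
import Data.Sum as Sum
open import Data.Empty using (⊥-elim)
open import Function.Base using (_∘_)
open import Function.Bundles using (_⇔_; mk⇔; Injection)
open import Function.Definitions using (Injective)
open import Function.Properties.Inverse using (↔⇒↣)
open import Relation.Unary using (Pred; Decidable)
open import Relation.Nullary using (¬_; Dec; yes; no; does)
open import Relation.Nullary.Decidable using (map′; _→-dec_; _⊎-dec_)
open import Relation.Binary.Definitions using (tri<; tri≈; tri>)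
open import Relation.Binary.PropositionalEquality

module _ {n : ℕ} where

  transpose-cases : (i j x : Fin n) →
    (x ≡ i × transpose i j x ≡ j) ⊎
    (x ≢ i × x ≡ j × transpose i j x ≡ i) ⊎
    (x ≢ i × x ≢ j × transpose i j x ≡ x)
  transpose-cases i j x with x ≟ i
  ... | yes x≡i = inj₁ (x≡i , refl)
  ... | no x≢i with x ≟ j
  ...   | yes x≡j = inj₂ (inj₁ (x≢i , x≡j , refl))
  ...   | no x≢j = inj₂ (inj₂ (x≢i , x≢j , refl))

  transpose-left : (i j : Fin n) → transpose i j i ≡ j
  transpose-left i j with transpose-cases i j i
  ... | inj₁ (_ , e) = e
  ... | inj₂ (inj₁ (i≢i , _)) = ⊥-elim (i≢i refl)
  ... | inj₂ (inj₂ (i≢i , _)) = ⊥-elim (i≢i refl)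

  transpose-right : (i j : Fin n) → transpose i j j ≡ i
  transpose-right i j with transpose-cases i j j
  ... | inj₁ (j≡i , e) = trans e j≡i
  ... | inj₂ (inj₁ (_ , _ , e)) = e
  ... | inj₂ (inj₂ (_ , j≢j , _)) = ⊥-elim (j≢j refl)

  transpose-fixes : (i j x : Fin n) → x ≢ i → x ≢ j → transpose i j x ≡ x
  transpose-fixes i j x x≢i x≢j with transpose-cases i j x
  ... | inj₁ (x≡i , _) = ⊥-elim (x≢i x≡i)
  ... | inj₂ (inj₁ (_ , x≡j , _)) = ⊥-elim (x≢j x≡j)
  ... | inj₂ (inj₂ (_ , _ , e)) = e

  transpose-sym : (i j x : Fin n) → transpose i j x ≡ transpose j i x
  transpose-sym i j x with transpose-cases i j x
  ... | inj₁ (refl , e) = trans e (sym (transpose-right j x))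
  ... | inj₂ (inj₁ (_ , refl , e)) = trans e (sym (transpose-left x i))
  ... | inj₂ (inj₂ (x≢i , x≢j , e)) = trans e (sym (transpose-fixes j i x x≢j x≢i))

  transpose-involutive : (i j x : Fin n) → transpose i j (transpose i j x) ≡ x
  transpose-involutive i j x =
    trans (cong (transpose i j) (transpose-sym i j x)) (transpose-inverse i j)

  transpose-injective : (i j : Fin n) → Injective _≡_ _≡_ (transpose i j)
  transpose-injective i j {x} {y} e =
    trans (sym (transpose-involutive i j x))
          (trans (cong (transpose i j) e) (transpose-involutive i j y))

  transpose-closed : (S : Fin n → Set) {i j x : Fin n} → S i → S j → S x → S (transpose i j x)
  transpose-closed S {i} {j} {x} si sj sx with transpose-cases i j x
  ... | inj₁ (_ , e) = subst S (sym e) sj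
  ... | inj₂ (inj₁ (_ , _ , e)) = subst S (sym e) si
  ... | inj₂ (inj₂ (_ , _ , e)) = subst S (sym e) sx

  transpose-conj : (σ : Fin n → Fin n) → Injective _≡_ _≡_ σ → (i j x : Fin n) →
    transpose (σ i) (σ j) (σ x) ≡ σ (transpose i j x)
  transpose-conj σ σ-inj i j x with transpose-cases i j x
  ... | inj₁ (refl , e) = trans (transpose-left (σ x) (σ j)) (cong σ (sym e))
  ... | inj₂ (inj₁ (_ , refl , e)) = trans (transpose-right (σ i) (σ x)) (cong σ (sym e))
  ... | inj₂ (inj₂ (x≢i , x≢j , e)) =
    trans (transpose-fixes (σ i) (σ j) (σ x) (x≢i ∘ σ-inj) (x≢j ∘ σ-inj)) (cong σ (sym e))

module _ {A : Set} where

  iterate-suc : (f : A → A) (x : A) (k : ℕ) → iterate f x (suc k) ≡ f (iterate f x k)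
  iterate-suc f x zero = refl
  iterate-suc f x (suc k) = iterate-suc f (f x) k

  iterate-+ : (f : A → A) (x : A) (j k : ℕ) → iterate f x (j + k) ≡ iterate f (iterate f x j) k
  iterate-+ f x zero k = refl
  iterate-+ f x (suc j) k = iterate-+ f (f x) j k

  iterate-shift : (f : A → A) (x : A) (i j d : ℕ) →
    iterate f x i ≡ iterate f x j → iterate f x (i + d) ≡ iterate f x (j + d)
  iterate-shift f x i j d e = begin
    iterate f x (i + d)          ≡⟨ iterate-+ f x i d ⟩
    iterate f (iterate f x i) d  ≡⟨ cong (λ z → iterate f z d) e ⟩
    iterate f (iterate f x j) d  ≡⟨ iterate-+ f x j d ⟨
    iterate f x (j + d)          ∎
    where open ≡-Reasoning

  iterate-cong : {f g : A → A} → (∀ x → f x ≡ g x) → ∀ x k → iterate f x k ≡ iterate g x k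
  iterate-cong f≗g x zero = refl
  iterate-cong {g = g} f≗g x (suc k) rewrite f≗g x = iterate-cong f≗g (g x) k

  iterate-injective : (f : A → A) → Injective _≡_ _≡_ f →
    ∀ k {x y} → iterate f x k ≡ iterate f y k → x ≡ y
  iterate-injective f f-inj zero e = e
  iterate-injective f f-inj (suc k) e = f-inj (iterate-injective f f-inj k e)

Least : (P : ℕ → Set) → Set
Least P = ∃ λ j → P j × (∀ i → i < j → ¬ P i)

least-or-none : {P : ℕ → Set} → Decidable P → ∀ k → Least P ⊎ (∀ i → i < k → ¬ P i)
least-or-none P? zero = inj₂ (λ _ ())
least-or-none {P} P? (suc k) with least-or-none P? k
... | inj₁ l = inj₁ l
... | inj₂ none with P? k
...   | yes pk = inj₁ (k , pk , none)
...   | no ¬pk = inj₂ below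
  where
  below : ∀ i → i < suc k → ¬ P i
  below i i<1+k with m<1+n⇒m<n∨m≡n i<1+k
  ... | inj₁ i<k = none i i<k
  ... | inj₂ refl = ¬pk

least : {P : ℕ → Set} → Decidable P → ∀ {k} → P k → Least P
least P? {k} pk with least-or-none P? (suc k)
... | inj₁ l = l
... | inj₂ none = ⊥-elim (none k ≤-refl pk)

module _ {n : ℕ} where

  -- y lies on the forward orbit of x under f.  For f = (v ⟨$⟩ʳ_) this is SameCycle v.
  Orbit : (Fin n → Fin n) → Fin n → Fin n → Set
  Orbit f x y = ∃ λ k → iterate f x k ≡ y

  orbit-refl : (f : Fin n → Fin n) (x : Fin n) → Orbit f x x
  orbit-refl f x = 0 , refl

  orbit-step : (f : Fin n → Fin n) (x : Fin n) → Orbit f x (f x)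
  orbit-step f x = 1 , refl

  orbit-trans : (f : Fin n → Fin n) {x y z : Fin n} → Orbit f x y → Orbit f y z → Orbit f x z
  orbit-trans f {x} (j , refl) (k , refl) = j + k , iterate-+ f x j k

  orbit-cong : {f g : Fin n → Fin n} → (∀ x → f x ≡ g x) → ∀ {x y} → Orbit f x y → Orbit g x y
  orbit-cong f≗g {x} (k , e) = k , trans (sym (iterate-cong f≗g x k)) e

  orbit-closed : (f : Fin n → Fin n) (S : Fin n → Set) → (∀ {y} → S y → S (f y)) →
    ∀ {x y} → S x → Orbit f x y → S y
  orbit-closed f S closed sx (zero , refl) = sx
  orbit-closed f S closed sx (suc k , e) = orbit-closed f S closed (closed sx) (k , e)

  -- By pigeonhole, every point of an orbit is reached within n steps.
  orbit-bounded : (f : Fin n → Fin n) (x : Fin n) (k : ℕ) →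
    ∃ λ k′ → k′ ≤ n × iterate f x k′ ≡ iterate f x k
  orbit-bounded f x = <-rec _ shorten
    where
    shorten : ∀ k → (∀ {j} → j < k → ∃ λ k′ → k′ ≤ n × iterate f x k′ ≡ iterate f x j) →
      ∃ λ k′ → k′ ≤ n × iterate f x k′ ≡ iterate f x k
    shorten k rec with k ≤? n
    ... | yes k≤n = k , k≤n , refl
    ... | no k≰n with pigeonhole (n<1+n n) (λ t → iterate f x (toℕ t))
    ...   | a , b , a<b , e = cut (toℕ a) (toℕ b) a<b e (≤-trans (toℕ≤pred[n] b) (<⇒≤ (≰⇒> k≰n)))
      where
      -- a repetition fⁱx = fʲx (i < j ≤ k) lets us replace k by the smaller i + (k ∸ j)
      cut : ∀ i j → i < j → iterate f x i ≡ iterate f x j → j ≤ k →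
        ∃ λ k′ → k′ ≤ n × iterate f x k′ ≡ iterate f x k
      cut i j i<j e j≤k with rec (subst (i + (k ∸ j) <_) (m+[n∸m]≡n j≤k) (+-monoˡ-< (k ∸ j) i<j))
      ... | k′ , k′≤n , e′ =
        k′ , k′≤n , trans e′ (trans (iterate-shift f x i j (k ∸ j) e)
                                    (cong (iterate f x) (m+[n∸m]≡n j≤k)))

  orbit? : (f : Fin n → Fin n) (x y : Fin n) → Dec (Orbit f x y)
  orbit? f x y = map′ fromFin toFin (any? (λ t → iterate f x (toℕ t) ≟ y))
    where
    fromFin : ∃ (λ (t : Fin (suc n)) → iterate f x (toℕ t) ≡ y) → Orbit f x y
    fromFin (t , e) = toℕ t , e
    toFin : Orbit f x y → ∃ (λ (t : Fin (suc n)) → iterate f x (toℕ t) ≡ y)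
    toFin (k , e) with orbit-bounded f x k
    ... | k′ , k′≤n , e′ =
      fromℕ< (s≤s k′≤n) , trans (cong (iterate f x) (toℕ-fromℕ< (s≤s k′≤n))) (trans e′ e)

  orbit-within-period : (g : Fin n → Fin n) (x : Fin n) (p : ℕ) → iterate g x (suc p) ≡ x →
    ∀ k → ∃ λ k′ → k′ < suc p × iterate g x k′ ≡ iterate g x k
  orbit-within-period g x p back zero = 0 , s≤s z≤n , refl
  orbit-within-period g x p back (suc k) with orbit-within-period g x p back k
  ... | k′ , k′<1+p , e with m<1+n⇒m<n∨m≡n k′<1+p
  ...   | inj₁ k′<p = suc k′ , s≤s k′<p ,
            trans (iterate-suc g x k′) (trans (cong g e) (sym (iterate-suc g x k)))
  ...   | inj₂ refl = 0 , s≤s z≤n ,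
            sym (trans (iterate-suc g x k) (trans (cong g (sym e)) (trans (sym (iterate-suc g x k′)) back)))

  orbit-missed : (g : Fin n → Fin n) (x y : Fin n) (p : ℕ) → iterate g x (suc p) ≡ x →
    (∀ t → t ≤ p → iterate g x t ≢ y) → ¬ Orbit g x y
  orbit-missed g x y p back avoids (k , e) with orbit-within-period g x p back k
  ... | k′ , s≤s k′≤p , e′ = avoids k′ k′≤p (trans e′ e)

  module _ {f : Fin n → Fin n} (f-inj : Injective _≡_ _≡_ f) where

    orbit-return : (x : Fin n) → ∃ λ p → iterate f x (suc p) ≡ x
    orbit-return x with pigeonhole (n<1+n n) (λ t → iterate f x (toℕ t))
    ... | a , b , a<b , e = d , sym (iterate-injective f f-inj (toℕ a) shifted)
      where
      d = toℕ b ∸ suc (toℕ a)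
      b≡d+a : suc d + toℕ a ≡ toℕ b
      b≡d+a = trans (+-comm (suc d) (toℕ a)) (trans (+-suc (toℕ a) d) (m+[n∸m]≡n a<b))
      shifted : iterate f x (toℕ a) ≡ iterate f (iterate f x (suc d)) (toℕ a)
      shifted = trans e (trans (cong (iterate f x) (sym b≡d+a)) (iterate-+ f x (suc d) (toℕ a)))

    orbit-sym : {x y : Fin n} → Orbit f x y → Orbit f y x
    orbit-sym {x} (k , refl) with orbit-return x
    ... | p , back with orbit-within-period f x p back k
    ...   | k′ , k′<1+p , e = suc p ∸ k′ , (begin
      iterate f (iterate f x k) (suc p ∸ k′)   ≡⟨ cong (λ z → iterate f z (suc p ∸ k′)) e ⟨
      iterate f (iterate f x k′) (suc p ∸ k′)  ≡⟨ iterate-+ f x k′ (suc p ∸ k′) ⟨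
      iterate f x (k′ + (suc p ∸ k′))          ≡⟨ cong (iterate f x) (m+[n∸m]≡n (<⇒≤ k′<1+p)) ⟩
      iterate f x (suc p)                      ≡⟨ back ⟩
      x                                        ∎)
      where open ≡-Reasoning

count : ∀ {n} {P : Pred (Fin n) 0ℓ} → Decidable P → ℕ
count {zero} P? = 0
count {suc n} P? = (if does (P? zero) then 1 else 0) + count (λ x → P? (suc x))

count-cong : ∀ {n} {P Q : Pred (Fin n) 0ℓ} (P? : Decidable P) (Q? : Decidable Q) →
  (∀ x → P x → Q x) → (∀ x → Q x → P x) → count P? ≡ count Q?
count-cong {zero} P? Q? P⇒Q Q⇒P = refl
count-cong {suc n} P? Q? P⇒Q Q⇒P with P? zero | Q? zero
... | yes _ | yes _ = cong suc (count-cong _ _ (P⇒Q ∘ suc) (Q⇒P ∘ suc))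
... | no _  | no _  = count-cong _ _ (P⇒Q ∘ suc) (Q⇒P ∘ suc)
... | yes p | no ¬q = ⊥-elim (¬q (P⇒Q zero p))
... | no ¬p | yes q = ⊥-elim (¬p (Q⇒P zero q))

count-≤ : ∀ {n} {P : Pred (Fin n) 0ℓ} (P? : Decidable P) → count P? ≤ n
count-≤ {zero} P? = z≤n
count-≤ {suc n} P? with P? zero
... | yes _ = s≤s (count-≤ (P? ∘ suc))
... | no _  = m≤n⇒m≤1+n (count-≤ (P? ∘ suc))

count-all : ∀ {n} {P : Pred (Fin n) 0ℓ} (P? : Decidable P) → (∀ x → P x) → count P? ≡ n
count-all {zero} P? all = refl
count-all {suc n} P? all with P? zero
... | yes _ = cong suc (count-all (P? ∘ suc) (all ∘ suc))
... | no ¬p = ⊥-elim (¬p (all zero))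

count-bump : ∀ {n} {P Q : Pred (Fin n) 0ℓ} (P? : Decidable P) (Q? : Decidable Q) (x₀ : Fin n) →
  P x₀ → ¬ Q x₀ → (∀ x → x ≢ x₀ → P x → Q x) → (∀ x → x ≢ x₀ → Q x → P x) →
  count P? ≡ suc (count Q?)
count-bump {suc n} P? Q? zero p ¬q P⇒Q Q⇒P with P? zero | Q? zero
... | no ¬p | _ = ⊥-elim (¬p p)
... | _ | yes q = ⊥-elim (¬q q)
... | yes _ | no _ =
  cong suc (count-cong _ _ (λ x → P⇒Q (suc x) λ ()) (λ x → Q⇒P (suc x) λ ()))
count-bump {suc n} P? Q? (suc x₀) p ¬q P⇒Q Q⇒P =
  head-agrees (count-bump (P? ∘ suc) (Q? ∘ suc) x₀ p ¬q
                 (λ x x≢x₀ → P⇒Q (suc x) (x≢x₀ ∘ suc-injective))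
                 (λ x x≢x₀ → Q⇒P (suc x) (x≢x₀ ∘ suc-injective)))
  where
  -- P and Q agree at zero, so the extra point of the tail is the only one
  head-agrees : count (P? ∘ suc) ≡ suc (count (Q? ∘ suc)) → count P? ≡ suc (count Q?)
  head-agrees tail with P? zero | Q? zero
  ... | yes _  | yes _  = cong suc tail
  ... | no _   | no _   = tail
  ... | yes p₀ | no ¬q₀ = ⊥-elim (¬q₀ (P⇒Q zero (λ ()) p₀))
  ... | no ¬p₀ | yes q₀ = ⊥-elim (¬p₀ (Q⇒P zero (λ ()) q₀))

fin-min : ∀ {n} (S : Pred (Fin n) 0ℓ) → Decidable S → ∀ {x} → S x →
  ∃ λ r → S r × (∀ y → S y → r ≤ᶠ y)
fin-min {suc n} S S? {x} sx with S? zero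
... | yes s₀ = zero , s₀ , λ _ _ → z≤n
fin-min {suc n} S S? {zero} sx | no ¬s₀ = ⊥-elim (¬s₀ sx)
fin-min {suc n} S S? {suc x} sx | no ¬s₀ with fin-min (S ∘ suc) (S? ∘ suc) sx
... | r , sr , r-least = suc r , sr , least-suc
  where
  least-suc : ∀ y → S y → suc r ≤ᶠ y
  least-suc zero s₀ = ⊥-elim (¬s₀ s₀)
  least-suc (suc y) sy = s≤s (r-least y sy)

module _ {n : ℕ} where

  Leader : (Fin n → Fin n) → Fin n → Set
  Leader f x = ∀ y → Orbit f x y → x ≤ᶠ y

  leader? : (f : Fin n → Fin n) → Decidable (Leader f)
  leader? f x = all? (λ y → orbit? f x y →-dec x ≤ᶠ? y)

  cycles : (Fin n → Fin n) → ℕ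
  cycles f = count (leader? f)

  leader-exists : (f : Fin n → Fin n) (x : Fin n) → ∃ λ r → Orbit f x r × Leader f r
  leader-exists f x with fin-min (Orbit f x) (orbit? f x) (orbit-refl f x)
  ... | r , xr , r-least = r , xr , λ y ry → r-least y (orbit-trans f xr ry)

  leader-unique : {f : Fin n → Fin n} → Injective _≡_ _≡_ f → ∀ {r r′} →
    Leader f r → Leader f r′ → Orbit f r r′ → r ≡ r′
  leader-unique f-inj lr lr′ rr′ = ≤ᶠ-antisym (lr _ rr′) (lr′ _ (orbit-sym f-inj rr′))

  cycles-cong : {f g : Fin n → Fin n} → (∀ x → f x ≡ g x) → cycles f ≡ cycles g
  cycles-cong f≗g = count-cong (leader? _) (leader? _)
    (λ x lx y xy → lx y (orbit-cong (sym ∘ f≗g) xy))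
    (λ x lx y xy → lx y (orbit-cong f≗g xy))

  cycles-id : cycles (λ x → x) ≡ n
  cycles-id = count-all (leader? _) λ x y (k , e) → ≤ᶠ-reflexive (trans (sym (iterate-id x k)) e)
    where
    iterate-id : ∀ (x : Fin n) k → iterate (λ z → z) x k ≡ x
    iterate-id x zero = refl
    iterate-id x (suc k) = iterate-id x k

  cycles-≤ : (f : Fin n → Fin n) → cycles f ≤ n
  cycles-≤ f = count-≤ (leader? f)

other-point : ∀ {A : Set} {p q r : A} → p ≢ q → r ≡ p ⊎ r ≡ q →
  ∃ λ x₀ → (x₀ ≡ p ⊎ x₀ ≡ q) × x₀ ≢ r × (∀ {x} → x ≡ p ⊎ x ≡ q → x ≢ x₀ → x ≡ r)
other-point {q = q} p≢q (inj₁ refl) = q , inj₂ refl , p≢q ∘ sym , λ where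
  (inj₁ x≡p) _ → x≡p
  (inj₂ x≡q) x≢q → ⊥-elim (x≢q x≡q)
other-point {p = p} p≢q (inj₂ refl) = p , inj₁ refl , p≢q , λ where
  (inj₁ x≡p) x≢p → ⊥-elim (x≢p x≡p)
  (inj₂ x≡q) _ → x≡q

module CycleSplit {n : ℕ} {f g : Fin n → Fin n}
  (f-inj : Injective _≡_ _≡_ f) (g-inj : Injective _≡_ _≡_ g) {a b : Fin n}
  (agree-outside : ∀ {x} → ¬ Orbit f a x → ∀ k → iterate g x k ≡ iterate f x k)
  (covered : ∀ {x} → Orbit f a x → Orbit g a x ⊎ Orbit g b x)
  (inside : ∀ {x} → Orbit g a x ⊎ Orbit g b x → Orbit f a x)
  (apart : ¬ Orbit g a b) where

  C : Fin n → Set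
  C = Orbit f a

  g-stays : ∀ {x y} → C x → Orbit g x y → C y
  g-stays cx xy = inside (Sum.map (λ ax → orbit-trans g ax xy) (λ bx → orbit-trans g bx xy) (covered cx))

  -- Off C, f and g have the same orbits and hence the same leaders.
  leader-outside : ∀ {x} → ¬ C x → (Leader g x → Leader f x) × (Leader f x → Leader g x)
  leader-outside ¬cx = (λ lx y (k , e) → lx y (k , trans (agree-outside ¬cx k) e))
                     , (λ lx y (k , e) → lx y (k , trans (sym (agree-outside ¬cx k)) e))

  f-leader-inside : ∀ {x r} → C x → C r → Leader f x → Leader f r → x ≡ r
  f-leader-inside cx cr lx lr = leader-unique f-inj lx lr (orbit-trans f (orbit-sym f-inj cx) cr)

  f-leader⇒g-leader : ∀ {x} → C x → Leader f x → Leader g x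
  f-leader⇒g-leader cx lx y xy = lx y (orbit-trans f (orbit-sym f-inj cx) (g-stays cx xy))

  -- Given the leader r of C under f and the leaders r₁, r₂ of the g-cycles of a and b,
  -- the g-leader among r₁, r₂ other than r is the one extra leader of g.
  module _ {r r₁ r₂ : Fin n} (cr : C r) (lr : Leader f r)
           (ar₁ : Orbit g a r₁) (l₁ : Leader g r₁) (br₂ : Orbit g b r₂) (l₂ : Leader g r₂) where

    r₁≢r₂ : r₁ ≢ r₂
    r₁≢r₂ refl = apart (orbit-trans g ar₁ (orbit-sym g-inj br₂))

    g-leader-inside : ∀ {x} → C x → Leader g x → x ≡ r₁ ⊎ x ≡ r₂
    g-leader-inside cx lx = Sum.map
      (λ ax → leader-unique g-inj lx l₁ (orbit-trans g (orbit-sym g-inj ax) ar₁))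
      (λ bx → leader-unique g-inj lx l₂ (orbit-trans g (orbit-sym g-inj bx) br₂))
      (covered cx)

    marked : ∀ {x} → x ≡ r₁ ⊎ x ≡ r₂ → C x × Leader g x
    marked (inj₁ refl) = inside (inj₁ ar₁) , l₁
    marked (inj₂ refl) = inside (inj₂ br₂) , l₂

    one-more : cycles g ≡ suc (cycles f)
    one-more with other-point r₁≢r₂ (g-leader-inside cr (f-leader⇒g-leader cr lr))
    ... | x₀ , x₀-marked , x₀≢r , only-r = count-bump (leader? g) (leader? f) x₀
          (proj₂ (marked x₀-marked))
          (λ lx₀ → x₀≢r (f-leader-inside (proj₁ (marked x₀-marked)) cr lx₀ lr))
          g⇒f f⇒g
      where
      g⇒f : ∀ x → x ≢ x₀ → Leader g x → Leader f x
      g⇒f x x≢x₀ lx with orbit? f a x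
      ... | yes cx = subst (Leader f) (sym (only-r (g-leader-inside cx lx) x≢x₀)) lr
      ... | no ¬cx = proj₁ (leader-outside ¬cx) lx
      f⇒g : ∀ x → x ≢ x₀ → Leader f x → Leader g x
      f⇒g x _ lx with orbit? f a x
      ... | yes cx = f-leader⇒g-leader cx lx
      ... | no ¬cx = proj₂ (leader-outside ¬cx) lx

  cycles-split : cycles g ≡ suc (cycles f)
  cycles-split with leader-exists f a | leader-exists g a | leader-exists g b
  ... | _ , ar , lr | _ , ar₁ , l₁ | _ , br₂ , l₂ = one-more ar lr ar₁ l₁ br₂ l₂

module TranspositionStep {n : ℕ} {f : Fin n → Fin n} (f-inj : Injective _≡_ _≡_ f)
                         {a b : Fin n} (a≢b : a ≢ b) where

  u : Fin n → Fin n
  u x = transpose a b (f x)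

  u-inj : Injective _≡_ _≡_ u
  u-inj = f-inj ∘ transpose-injective a b

  Returns : ℕ → Set
  Returns j = iterate f a (suc j) ≡ a ⊎ iterate f a (suc j) ≡ b

  first-return : Least Returns
  first-return = least (λ j → iterate f a (suc j) ≟ a ⊎-dec iterate f a (suc j) ≟ b)
                       {proj₁ (orbit-return f-inj a)} (inj₁ (proj₂ (orbit-return f-inj a)))

  j : ℕ
  j = proj₁ first-return

  avoids-b : ∀ t → t ≤ j → iterate f a t ≢ b
  avoids-b zero _ = a≢b
  avoids-b (suc t) t<j = proj₂ (proj₂ first-return) t t<j ∘ inj₂

  agree : ∀ t → t ≤ j → iterate u a t ≡ iterate f a t
  agree zero _ = refl
  agree (suc t) t<j = begin
    iterate u a (suc t)                  ≡⟨ iterate-suc u a t ⟩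
    u (iterate u a t)                    ≡⟨ cong u (agree t (<⇒≤ t<j)) ⟩
    transpose a b (f (iterate f a t))    ≡⟨ cong (transpose a b) (iterate-suc f a t) ⟨
    transpose a b (iterate f a (suc t))  ≡⟨ transpose-fixes a b _ (no-return ∘ inj₁) (no-return ∘ inj₂) ⟩
    iterate f a (suc t)                  ∎
    where
    open ≡-Reasoning
    no-return = proj₂ (proj₂ first-return) t t<j

  at-return : iterate u a (suc j) ≡ transpose a b (iterate f a (suc j))
  at-return = trans (iterate-suc u a j)
                    (trans (cong u (agree j ≤-refl)) (cong (transpose a b) (sym (iterate-suc f a j))))

  -- Exactly one of f, u has a and b on a common cycle: if f returns to a first, u is
  -- sent on to b; if f reaches b first, u is sent back to a.
  exactly-one : (Orbit f a b × ¬ Orbit u a b) ⊎ (¬ Orbit f a b × Orbit u a b)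
  exactly-one with proj₁ (proj₂ first-return)
  ... | inj₁ back-at-a = inj₂ (orbit-missed f a b j back-at-a avoids-b ,
          (suc j , trans at-return (trans (cong (transpose a b) back-at-a) (transpose-left a b))))
  ... | inj₂ at-b = inj₁ ((suc j , at-b) ,
          orbit-missed u a b j (trans at-return (trans (cong (transpose a b) at-b) (transpose-right a b)))
            (λ t t≤j → subst (_≢ b) (sym (agree t t≤j)) (avoids-b t t≤j)))

  split : Orbit f a b → cycles u ≡ suc (cycles f)
  split ab = CycleSplit.cycles-split f-inj u-inj agree-outside covered inside apart
    where
    apart : ¬ Orbit u a b
    apart with exactly-one
    ... | inj₁ (_ , ¬ab) = ¬ab
    ... | inj₂ (¬ab , _) = ⊥-elim (¬ab ab)

    -- an orbit missing a (and thus b) is untouched by (a b)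
    agree-outside : ∀ {x} → ¬ Orbit f a x → ∀ k → iterate u x k ≡ iterate f x k
    agree-outside ¬ax zero = refl
    agree-outside {x} ¬ax (suc k) = begin
      iterate u x (suc k)                  ≡⟨ iterate-suc u x k ⟩
      u (iterate u x k)                    ≡⟨ cong u (agree-outside ¬ax k) ⟩
      transpose a b (f (iterate f x k))    ≡⟨ cong (transpose a b) (iterate-suc f x k) ⟨
      transpose a b (iterate f x (suc k))  ≡⟨ transpose-fixes a b _ not-a not-b ⟩
      iterate f x (suc k)                  ∎
      where
      open ≡-Reasoning
      not-a : iterate f x (suc k) ≢ a
      not-a e = ¬ax (orbit-sym f-inj (suc k , e))
      not-b : iterate f x (suc k) ≢ b
      not-b e = ¬ax (orbit-trans f ab (orbit-sym f-inj (suc k , e)))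

    -- the union of the u-cycles of a and b is closed under f, so it contains C
    covered : ∀ {x} → Orbit f a x → Orbit u a x ⊎ Orbit u b x
    covered = orbit-closed f (λ y → Orbit u a y ⊎ Orbit u b y) f-step (inj₁ (orbit-refl u a))
      where
      f-step : ∀ {y} → Orbit u a y ⊎ Orbit u b y → Orbit u a (f y) ⊎ Orbit u b (f y)
      f-step {y} uy with transpose-cases a b (f y)
      ... | inj₁ (fy≡a , _) = inj₁ (0 , sym fy≡a)
      ... | inj₂ (inj₁ (_ , fy≡b , _)) = inj₂ (0 , sym fy≡b)
      ... | inj₂ (inj₂ (_ , _ , uy≡fy)) =
        Sum.map (λ o → orbit-trans u o (1 , uy≡fy)) (λ o → orbit-trans u o (1 , uy≡fy)) uy

    -- C contains a and b and is closed under u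
    inside : ∀ {x} → Orbit u a x ⊎ Orbit u b x → Orbit f a x
    inside = Sum.[ orbit-closed u C u-step (orbit-refl f a) , orbit-closed u C u-step ab ]
      where
      C = Orbit f a
      u-step : ∀ {y} → C y → C (u y)
      u-step {y} cy = transpose-closed C (orbit-refl f a) ab (orbit-trans f cy (orbit-step f y))

  join : ¬ Orbit f a b → Orbit u a b
  join ¬ab with exactly-one
  ... | inj₁ (ab , _) = ⊥-elim (¬ab ab)
  ... | inj₂ (_ , ab) = ab

cycles-merge : ∀ {n} {f : Fin n → Fin n} → Injective _≡_ _≡_ f → ∀ {a b} → a ≢ b →
  ¬ Orbit f a b → cycles f ≡ suc (cycles (λ x → transpose a b (f x)))
cycles-merge {f = f} f-inj {a} {b} a≢b ¬ab =
  trans (cycles-cong (λ x → sym (transpose-involutive a b (f x))))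
        (TranspositionStep.split u-inj a≢b (join ¬ab))
  where open TranspositionStep f-inj a≢b using (u; u-inj; join)

module _ {n : ℕ} where

  Proper : List (Fin n × Fin n) → Set
  Proper = All (λ p → proj₁ p ≢ proj₂ p)

  evalTransp-injective : (W : List (Fin n × Fin n)) → Injective _≡_ _≡_ (evalTransp W)
  evalTransp-injective [] e = e
  evalTransp-injective ((i , j) ∷ W) e = evalTransp-injective W (transpose-injective i j e)

  -- Each letter changes the number of cycles by one, so a product of ℓ transpositions
  -- has cycles + ℓ ≡ n (mod 2) and cycles + ℓ ≥ n.
  cycles-word : (W : List (Fin n × Fin n)) → Proper W →
    ∃ λ e → cycles (evalTransp W) + length W ≡ n + 2 * e
  cycles-word [] [] = 0 , trans (+-identityʳ _) (trans cycles-id (sym (+-identityʳ n)))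
  cycles-word ((a , b) ∷ W) (a≢b ∷ proper) with cycles-word W proper | orbit? (evalTransp W) a b
  ... | e , c+ℓ≡n+2e | yes ab = suc e , (begin
    cycles g + suc (length W)            ≡⟨ cong (_+ suc (length W)) (split ab) ⟩
    suc (cycles f) + suc (length W)      ≡⟨ cong suc (+-suc (cycles f) (length W)) ⟩
    suc (suc (cycles f + length W))      ≡⟨ cong (λ (z : ℕ) → suc (suc z)) c+ℓ≡n+2e ⟩
    suc (suc (n + 2 * e))                ≡⟨ cong suc (+-suc n (2 * e)) ⟨
    suc (n + suc (2 * e))                ≡⟨ +-suc n (suc (2 * e)) ⟨
    n + suc (suc (2 * e))                ≡⟨ cong (n +_) (*-suc 2 e) ⟨
    n + 2 * suc e                        ∎)
    where
    open ≡-Reasoning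
    open TranspositionStep (evalTransp-injective W) a≢b renaming (u to g)
    f = evalTransp W
  ... | e , c+ℓ≡n+2e | no ¬ab = e , (begin
    cycles g + suc (length W)            ≡⟨ +-suc (cycles g) (length W) ⟩
    suc (cycles g) + length W            ≡⟨ cong (_+ length W) (cycles-merge (evalTransp-injective W) a≢b ¬ab) ⟨
    cycles (evalTransp W) + length W     ≡⟨ c+ℓ≡n+2e ⟩
    n + 2 * e                            ∎)
    where
    open ≡-Reasoning
    g = λ x → transpose a b (evalTransp W x)

  Factorisation : (Fin n → Fin n) → ℕ → Set
  Factorisation f k = ∃ λ W → Proper W × length W ≡ k × (∀ x → f x ≡ evalTransp W x)

  -- Conversely a permutation with c cycles is a product of n ∸ c transpositions: peel off
  -- (a  f a) for a moved point a, which splits a cycle, until f is the identity.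
  factorise : ∀ k {f : Fin n → Fin n} → Injective _≡_ _≡_ f → k + cycles f ≡ n → Factorisation f k
  factorise k {f} f-inj k+c≡n with all? (λ x → f x ≟ x)
  ... | yes fixed = [] , [] , sym k≡0 , fixed
    where
    k≡0 : k ≡ 0
    k≡0 = +-cancelʳ-≡ (cycles f) k 0 (trans k+c≡n (trans (sym cycles-id) (cycles-cong (sym ∘ fixed))))
  ... | no ¬fixed with ¬∀⟶∃¬ n _ (λ x → f x ≟ x) ¬fixed
  ...   | a , fa≢a = peel k k+c≡n
    where
    open TranspositionStep f-inj (fa≢a ∘ sym) using (u; u-inj; split)
    one-more : cycles u ≡ suc (cycles f)
    one-more = split (orbit-step f a)
    peel : ∀ k → k + cycles f ≡ n → Factorisation f k
    peel zero c≡n = ⊥-elim (1+n≰n (subst (_≤ n) (trans one-more (cong suc c≡n)) (cycles-≤ u)))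
    peel (suc k) k+1+c≡n with factorise k u-inj (trans (cong (k +_) one-more) (trans (+-suc k (cycles f)) k+1+c≡n))
    ... | W , proper , length≡k , u≗W = (a , f a) ∷ W , (fa≢a ∘ sym) ∷ proper , cong suc length≡k ,
          λ x → trans (sym (transpose-involutive a (f a) (f x))) (cong (transpose a (f a)) (u≗W x))

permutation-injective : ∀ {n} (v : Permutation′ n) → Injective _≡_ _≡_ (v ⟨$⟩ʳ_)
permutation-injective v = Injection.injective (↔⇒↣ v)

module _ {m : ℕ} where

  s : Fin (2+ m) → Fin (2+ m)
  s = transpose zero (suc zero)

  sPow : ℕ → Fin (2+ m) → Fin (2+ m)
  sPow zero x = x
  sPow (suc k) x = s (sPow k x)

  sPow-s : ∀ k x → sPow k (s x) ≡ s (sPow k x)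
  sPow-s zero x = refl
  sPow-s (suc k) x = cong s (sPow-s k x)

  sPow-suc-s : ∀ k x → sPow (suc k) (s x) ≡ sPow k x
  sPow-suc-s k x = trans (cong s (sPow-s k x)) (transpose-involutive zero (suc zero) (sPow k x))

  sPow-involutive : ∀ k x → sPow k (sPow k x) ≡ x
  sPow-involutive zero x = refl
  sPow-involutive (suc k) x = trans (sPow-suc-s k (sPow k x)) (sPow-involutive k x)

  sPow-injective : ∀ k → Injective _≡_ _≡_ (sPow k)
  sPow-injective k {x} {y} e =
    trans (sym (sPow-involutive k x)) (trans (cong (sPow k) e) (sPow-involutive k y))

  sPow-even : ∀ {k} → Even k → ∀ x → sPow k x ≡ x
  sPow-even (zero , refl) x = refl
  sPow-even (suc h , refl) x = begin
    sPow (2 * suc h) x              ≡⟨ cong (λ k → sPow k x) (*-suc 2 h) ⟩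
    s (s (sPow (2 * h) x))          ≡⟨ transpose-involutive zero (suc zero) _ ⟩
    sPow (2 * h) x                  ≡⟨ sPow-even (h , refl) x ⟩
    x                               ∎
    where open ≡-Reasoning

  sPow-odd : ∀ {k} → Odd k → ∀ x → sPow k x ≡ s x
  sPow-odd (h , refl) x = cong s (sPow-even (h , refl) x)

  sPow-cases : ∀ k → (∀ x → sPow k x ≡ x) ⊎ (∀ x → sPow k x ≡ s x)
  sPow-cases zero = inj₁ (λ _ → refl)
  sPow-cases (suc k) with sPow-cases k
  ... | inj₁ id = inj₂ (λ x → cong s (id x))
  ... | inj₂ is-s = inj₁ (λ x → trans (cong s (is-s x)) (transpose-involutive zero (suc zero) x))

  -- Untwisting a word in T(A_n): if k generators follow (1 2)(i j), moving the k copies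
  -- of (1 2) to the left conjugates (i j) by sᵏ.  So sᵏ · t₁⋯t_k is a product of k
  -- transpositions.
  untwist : List (TIndex (2+ m)) → List (Fin (2+ m) × Fin (2+ m))
  untwist [] = []
  untwist (((i , j) , _) ∷ w) = (sPow (length w) i , sPow (length w) j) ∷ untwist w

  untwist-length : ∀ w → length (untwist w) ≡ length w
  untwist-length [] = refl
  untwist-length (_ ∷ w) = cong suc (untwist-length w)

  untwist-proper : ∀ w → Proper (untwist w)
  untwist-proper [] = []
  untwist-proper (((i , j) , i<j) ∷ w) = (<⇒≢ i<j ∘ sPow-injective (length w)) ∷ untwist-proper w

  untwist-correct : ∀ w x → sPow (length w) (evalT w x) ≡ evalTransp (untwist w) x
  untwist-correct [] x = refl
  untwist-correct (((i , j) , _) ∷ w) x = begin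
    sPow (suc k) (s (transpose i j y))  ≡⟨ sPow-suc-s k _ ⟩
    sPow k (transpose i j y)            ≡⟨ transpose-conj (sPow k) (sPow-injective k) i j y ⟨
    transpose (sPow k i) (sPow k j) (sPow k y)
      ≡⟨ cong (transpose (sPow k i) (sPow k j)) (untwist-correct w x) ⟩
    transpose (sPow k i) (sPow k j) (evalTransp (untwist w) x)  ∎
    where
    open ≡-Reasoning
    k = length w
    y = evalT w x

  generator : (i j : Fin (2+ m)) → i ≢ j →
    Σ (TIndex (2+ m)) λ t → ∀ x → applyT t x ≡ s (transpose i j x)
  generator i j i≢j with <-cmp i j
  ... | tri< i<j _ _ = ((i , j) , i<j) , λ _ → refl
  ... | tri≈ _ i≡j _ = ⊥-elim (i≢j i≡j)
  ... | tri> _ _ j<i = ((j , i) , j<i) , λ x → cong s (transpose-sym j i x)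

  -- Twisting, the inverse translation: the transposition (i j) followed by k letters
  -- becomes the generator (1 2)(sᵏi sᵏj).
  twisted : (k : ℕ) (i j : Fin (2+ m)) → i ≢ j → Σ (TIndex (2+ m)) λ t →
    ∀ x → applyT t x ≡ s (transpose (sPow k i) (sPow k j) x)
  twisted k i j i≢j = generator (sPow k i) (sPow k j) (i≢j ∘ sPow-injective k)

  twist : (W : List (Fin (2+ m) × Fin (2+ m))) → Proper W → List (TIndex (2+ m))
  twist [] [] = []
  twist ((i , j) ∷ W) (i≢j ∷ proper) = proj₁ (twisted (length W) i j i≢j) ∷ twist W proper

  twist-length : ∀ W proper → length (twist W proper) ≡ length W
  twist-length [] [] = refl
  twist-length (_ ∷ W) (_ ∷ proper) = cong suc (twist-length W proper)

  twist-correct : ∀ W proper x → sPow (length W) (evalT (twist W proper) x) ≡ evalTransp W x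
  twist-correct [] [] x = refl
  twist-correct ((i , j) ∷ W) (i≢j ∷ proper) x = begin
    sPow (suc k) (applyT (proj₁ (twisted k i j i≢j)) y)
      ≡⟨ cong (sPow (suc k)) (proj₂ (twisted k i j i≢j) y) ⟩
    sPow (suc k) (s (transpose (sPow k i) (sPow k j) y))  ≡⟨ sPow-suc-s k _ ⟩
    sPow k (transpose (sPow k i) (sPow k j) y)
      ≡⟨ transpose-conj (sPow k) (sPow-injective k) (sPow k i) (sPow k j) y ⟨
    transpose (sPow k (sPow k i)) (sPow k (sPow k j)) (sPow k y)
      ≡⟨ cong₂ (λ p q → transpose p q (sPow k y)) (sPow-involutive k i) (sPow-involutive k j) ⟩
    transpose i j (sPow k y)  ≡⟨ cong (transpose i j) (twist-correct W proper x) ⟩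
    transpose i j (evalTransp W x)  ∎
    where
    open ≡-Reasoning
    k = length W
    y = evalT (twist W proper) x

  tproduct-lower : (v : Permutation′ (2+ m)) {k : ℕ} → IsTProduct v k →
    2+ m ≤ cycles (λ x → sPow k (v ⟨$⟩ʳ x)) + k
  tproduct-lower v (w , refl , v≗w) with cycles-word (untwist w) (untwist-proper w)
  ... | e , c+ℓ≡n+2e = subst (2+ m ≤_) (sym c+k≡n+2e) (m≤m+n (2+ m) (2 * e))
    where
    c+k≡n+2e : cycles (λ x → sPow (length w) (v ⟨$⟩ʳ x)) + length w ≡ 2+ m + 2 * e
    c+k≡n+2e = trans (cong₂ _+_ (cycles-cong (λ x → trans (cong (sPow (length w)) (v≗w x)) (untwist-correct w x)))
                                (sym (untwist-length w)))
                     c+ℓ≡n+2e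

  tproduct-upper : (v : Permutation′ (2+ m)) (k : ℕ) →
    k + cycles (λ x → sPow k (v ⟨$⟩ʳ x)) ≡ 2+ m → IsTProduct v k
  tproduct-upper v k k+c≡n with factorise k (permutation-injective v ∘ sPow-injective k) k+c≡n
  ... | W , proper , refl , sv≗W = twist W proper , twist-length W proper ,
        λ x → sPow-injective (length W) (trans (sv≗W x) (sym (twist-correct W proper x)))

defect-≤ : ∀ {k c n k′} → k + c ≡ n → n ≤ c + k′ → k ≤ k′
defect-≤ {k} {c} {n} {k′} k+c≡n n≤c+k′ =
  +-cancelˡ-≤ c k k′ (subst (_≤ c + k′) (trans (sym k+c≡n) (+-comm k c)) n≤c+k′)

even-suc⇒odd : ∀ {k} → Even (suc k) → Odd k
even-suc⇒odd (zero , ())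
even-suc⇒odd (suc h , 1+k≡2[1+h]) = h , ℕ-suc-injective (trans 1+k≡2[1+h] (*-suc 2 h))

module _ {m : ℕ} (v : Permutation′ (2+ m)) where

  even-defect : IsEvenPerm v → ∃ λ d → Even d × d + cycles (v ⟨$⟩ʳ_) ≡ 2+ m
  even-defect (W , proper , (h , ℓ≡2h) , v≗W) with cycles-word W proper
  ... | e , c+ℓ≡n+2e = 2+ m ∸ c , (h ∸ e , d≡2[h∸e]) , m∸n+n≡m (cycles-≤ (v ⟨$⟩ʳ_))
    where
    c = cycles (v ⟨$⟩ʳ_)
    c+2h≡n+2e : c + 2 * h ≡ 2+ m + 2 * e
    c+2h≡n+2e = trans (cong₂ _+_ (cycles-cong v≗W) (sym ℓ≡2h)) c+ℓ≡n+2e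
    d≡2[h∸e] : 2+ m ∸ c ≡ 2 * (h ∸ e)
    d≡2[h∸e] = begin
      2+ m ∸ c                          ≡⟨ [m+n]∸[m+o]≡n∸o (2 * e) (2+ m) c ⟨
      (2 * e + 2+ m) ∸ (2 * e + c)      ≡⟨ cong₂ _∸_ (+-comm (2 * e) (2+ m)) (+-comm (2 * e) c) ⟩
      (2+ m + 2 * e) ∸ (c + 2 * e)      ≡⟨ cong (_∸ (c + 2 * e)) c+2h≡n+2e ⟨
      (c + 2 * h) ∸ (c + 2 * e)         ≡⟨ [m+n]∸[m+o]≡n∸o c (2 * h) (2 * e) ⟩
      2 * h ∸ 2 * e                     ≡⟨ *-distribˡ-∸ 2 h e ⟨
      2 * (h ∸ e)                       ∎
      where open ≡-Reasoning

  -- Writing c, c′ for the numbers of cycles of v and of (1 2)·v, c′ = c ± 1 according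
  -- as 1, 2 share a cycle of v or not.
  open TranspositionStep (permutation-injective v) {zero} {suc zero} (λ ())
    renaming (u to sv) using (split)

  same-cycle⇒odd-length : IsEvenPerm v → SameCycle v zero (suc zero) →
    ∃ λ k → HasTLength v k × Odd k
  same-cycle⇒odd-length even same with even-defect even
  ... | d , d-even , d+c≡n = k , (tproduct-upper v k k+c′≡n′ , minimal) , k-odd
    where
    c′≡1+c : cycles sv ≡ suc (cycles (v ⟨$⟩ʳ_))
    c′≡1+c = split same
    k = 2+ m ∸ cycles sv
    k+c′≡n : k + cycles sv ≡ 2+ m
    k+c′≡n = m∸n+n≡m (cycles-≤ sv)
    k-odd : Odd k
    k-odd = even-suc⇒odd (subst Even (sym 1+k≡d) d-even)
      where
      1+k≡d : suc k ≡ d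
      1+k≡d = +-cancelʳ-≡ (cycles (v ⟨$⟩ʳ_)) (suc k) d
        (trans (sym (+-suc k _)) (trans (cong (k +_) (sym c′≡1+c)) (trans k+c′≡n (sym d+c≡n))))
    k+c′≡n′ : k + cycles (λ x → sPow k (v ⟨$⟩ʳ x)) ≡ 2+ m
    k+c′≡n′ = trans (cong (k +_) (cycles-cong (λ x → sPow-odd k-odd (v ⟨$⟩ʳ x)))) k+c′≡n
    -- sᵏv is v or (1 2)v, so it has at most c′ cycles
    at-most-c′ : ∀ k′ → cycles (λ x → sPow k′ (v ⟨$⟩ʳ x)) ≤ cycles sv
    at-most-c′ k′ with sPow-cases k′
    ... | inj₁ is-id = subst (_≤ cycles sv) (sym (cycles-cong (is-id ∘ (v ⟨$⟩ʳ_))))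
                             (subst (cycles (v ⟨$⟩ʳ_) ≤_) (sym c′≡1+c) (n≤1+n _))
    ... | inj₂ is-s = ≤-reflexive (cycles-cong (is-s ∘ (v ⟨$⟩ʳ_)))
    minimal : ∀ k′ → IsTProduct v k′ → k ≤ k′
    minimal k′ k′-prod =
      defect-≤ k+c′≡n (≤-trans (tproduct-lower v k′-prod) (+-monoˡ-≤ k′ (at-most-c′ k′)))

  -- If 1 and 2 lie on different cycles, the even number n ∸ c beats every odd length.
  odd-length⇒same-cycle : IsEvenPerm v → (∃ λ k → HasTLength v k × Odd k) →
    SameCycle v zero (suc zero)
  odd-length⇒same-cycle even (k , (k-prod , k-min) , k-odd) with orbit? (v ⟨$⟩ʳ_) zero (suc zero)
  ... | yes same = same
  ... | no apart with even-defect even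
  ...   | d , d-even , d+c≡n = ⊥-elim (≤⇒≯ (k-min d d-prod) d<k)
    where
    c≡1+c′ : cycles (v ⟨$⟩ʳ_) ≡ suc (cycles sv)
    c≡1+c′ = cycles-merge (permutation-injective v) (λ ()) apart
    d-prod : IsTProduct v d
    d-prod = tproduct-upper v d (trans (cong (d +_) (cycles-cong (λ x → sPow-even d-even (v ⟨$⟩ʳ x)))) d+c≡n)
    d<k : suc d ≤ k
    d<k = defect-≤ (trans (sym (+-suc d _)) (trans (cong (d +_) (sym c≡1+c′)) d+c≡n))
                   (subst (λ c → 2+ m ≤ c + k) (cycles-cong (λ x → sPow-odd k-odd (v ⟨$⟩ʳ x)))
                          (tproduct-lower v k-prod))

corollary6p2 : (m : ℕ) (v : Permutation′ (suc (suc m))) → IsEvenPerm v →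
    SameCycle v zero (suc zero) ⇔ (∃ λ k → HasTLength v k × Odd k)
corollary6p2 m v even = mk⇔ (same-cycle⇒odd-length v even) (odd-length⇒same-cycle v even)
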